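{- Let $k\ge 1$ be an integer and let $P$ be a proper logic program. Then $P$ has a stable model of cardinality $k$ if and only if there is a set $A\subseteq \mathrm{At}(P)$ with $|A|=k-1$ such that $P$ has an $A$-based stable model.
   Context: A logic program is a finite set of rules $r$ of the form $a \leftarrow b_1,\ldots,b_s,\mathbf{not}(c_1),\ldots,\mathbf{not}(c_t)$ ($a,b_i,c_j$ propositional atoms, no repeated atoms within $b^+(r)$ or within $b^-(r)$); $h(r)=a$, $b^+(r)=\{b_1,\ldots,b_s\}$, $b^-(r)=\{c_1,\ldots,c_t\}$; $\mathrm{At}(P)$ is the set of atoms of $P$. For $M\subseteq\mathrm{At}(P)$, the reduct $P^M$ is obtained by deleting every rule $r$ with $b^-(r)\cap M\neq\emptyset$ and deleting negated atoms from the remaining rules; $LM(\cdot)$ denotes the least model of a Horn program; $M$ is a stable model of $P$ if $M=LM(P^M)$. A rule $r$ is proper if $h(r)\notin b^+(r)$ and $b^+(r)\cap b^-(r)=\emptyset$; a program is proper if all its rules are. For a set of atoms $A$, $P(A)$ is the program consisting of all rules $r\in P$ with $b^-(r)\cap A=\emptyset$ and $b^+(r)\subseteq A$. A stable model $M$ of $P$ is $A$-based if $M=A\cup\{a\}$ for some $a\in\mathrm{At}(P)\setminus A$ and $M\subseteq LM(P(A)^M)$. -}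

module Defs where

open import Data.Nat using (ℕ; _≟_)
open import Data.List using (List; []; _∷_; filter; map; concatMap; _++_)
open import Data.List.Membership.Propositional using (_∈_; _∉_)
open import Data.List.Membership.DecPropositional _≟_ using (_∈?_)
open import Data.List.Relation.Unary.All using (All; all?)
open import Data.List.Relation.Unary.Unique.Propositional using (Unique)
open import Data.Product using (_×_; _,_; Σ)
open import Data.Sum using (_⊎_)
open import Relation.Nullary using (¬_)
open import Relation.Nullary.Decidable using (¬?; _×-dec_)
open import Relation.Binary.PropositionalEquality using (_≡_)
open import Function.Bundles using (_⇔_)

Atom : Set
Atom = ℕ

record Rule : Set where
  constructor mkRule
  field
    h     : Atom
    bPos  : List Atom
    bNeg  : List Atom
open Rule public

WellFormedRule : Rule → Set
WellFormedRule r = Unique (bPos r) × Unique (bNeg r)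

-- A logic program: a finite set of rules (a list; only membership matters).
Program : Set
Program = List Rule

WellFormed : Program → Set
WellFormed P = All WellFormedRule P

At : Program → List Atom
At P = concatMap (λ r → h r ∷ (bPos r ++ bNeg r)) P

Disjoint : List Atom → List Atom → Set
Disjoint xs ys = All (λ x → x ∉ ys) xs

ProperRule : Rule → Set
ProperRule r = (h r ∉ bPos r) × Disjoint (bPos r) (bNeg r)

Proper : Program → Set
Proper P = All ProperRule P

-- Horn rules and least models (the least model of a Horn program is the
-- set of atoms derivable from it).
record HornRule : Set where
  constructor mkHorn
  field
    hd   : Atom
    body : List Atom
open HornRule public

HornProgram : Set
HornProgram = List HornRule

data Derivable (H : HornProgram) : Atom → Set where
  step : ∀ {r} → r ∈ H → All (Derivable H) (body r) → Derivable H (hd r)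

_∈LM_ : Atom → HornProgram → Set
a ∈LM H = Derivable H a

disjoint? : (xs ys : List Atom) → Relation.Nullary.Dec (Disjoint xs ys)
disjoint? xs ys = all? (λ x → ¬? (x ∈? ys)) xs

reduct : Program → List Atom → HornProgram
reduct P M = map (λ r → mkHorn (h r) (bPos r)) (filter (λ r → disjoint? (bNeg r) M) P)

_≐_ : List Atom → List Atom → Set
X ≐ Y = ∀ x → (x ∈ X) ⇔ (x ∈ Y)

_⊆_ : List Atom → List Atom → Set
X ⊆ Y = ∀ {x} → x ∈ X → x ∈ Y

StableModel : Program → List Atom → Set
StableModel P M = M ⊆ At P × (∀ a → (a ∈ M) ⇔ (a ∈LM reduct P M))

restrict : Program → List Atom → Program
restrict P A =
  filter (λ r → disjoint? (bNeg r) A ×-dec all? (λ b → b ∈? A) (bPos r)) P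

ABased : Program → List Atom → List Atom → Set
ABased P A M =
  StableModel P M
  × Σ Atom (λ a → a ∈ At P × a ∉ A
      × (∀ x → (x ∈ M) ⇔ ((x ≡ a) ⊎ (x ∈ A))))
  × (∀ {x} → x ∈ M → x ∈LM reduct (restrict P A) M)

-- Let M be a stable model with k ≥ 1 atoms and grade the derivations of the
-- least model of P^M by their depth. Since every atom of M is derivable,
-- there is a depth n at which not all of M is derived yet but all of M is
-- derived at depth n + 1. Pick a ∈ M not derived at depth n and let
-- A = M ∖ {a}. Every atom derived at depth n lies in M and differs from a,
-- hence lies in A, so every rule fired up to depth n + 1 has its positive
-- body in A and its negative body outside M ⊇ A; it is therefore a rule of
-- P(A), and M ⊆ LM(P(A)^M). Conversely an A-based stable model is the stable
-- model A ∪ {a} of cardinality |A| + 1.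
module Submission where

open import Defs
open import Data.Nat using (ℕ; _≤_; _∸_; zero; suc; s≤s; _⊔_; _≟_)
open import Data.Nat.Properties using (m≤m⊔n; m≤n⊔m; n≤1+n; suc-injective)
open import Data.List using (List; length; []; _∷_)
open import Data.List.Relation.Unary.Unique.Propositional using (Unique)
open import Data.List.Relation.Unary.AllPairs using (_∷_)
open import Data.List.Relation.Unary.All as All using (All; []; _∷_; all?)
open import Data.List.Relation.Unary.All.Properties using (¬All⇒Any¬; ¬Any⇒All¬; All¬⇒¬Any)
open import Data.List.Relation.Unary.Any as Any using (Any; here; there; any?)
open import Data.List.Relation.Unary.Any.Properties using (∷↔)
open import Data.List.Membership.Propositional using (_∈_; _∉_; find; lose)
open import Data.List.Membership.Propositional.Properties using (∈-filter⁺; ∈-filter⁻; ∈-map⁺; ∈-map⁻; ∈-∃++)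
open import Data.List.Relation.Binary.Permutation.Propositional using (_↭_; ↭-sym; ↭⇒↭ₛ)
open import Data.List.Relation.Binary.Permutation.Propositional.Properties using (shift; ↭-length; ∈-resp-↭)
open import Data.List.Relation.Binary.Permutation.Setoid.Properties using (Unique-resp-↭)
open import Data.Product using (Σ; ∃; _×_; _,_; proj₁; proj₂)
open import Data.Sum using (_⊎_; inj₁; inj₂)
open import Data.Empty using (⊥)
open import Function using (_∘_)
open import Function.Bundles using (_⇔_; mk⇔; Equivalence)
open import Function.Construct.Composition using (_⇔-∘_)
open import Function.Properties.Inverse using (↔⇒⇔)
open import Function.Properties.Equivalence using () renaming (sym to ⇔-sym)
open import Relation.Binary.PropositionalEquality using (_≡_; refl; sym; trans; cong; setoid)
open import Relation.Nullary using (¬_; yes; no; contradiction)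
open import Relation.Nullary.Decidable using (_×-dec_)
open import Relation.Unary using (Decidable)

open Equivalence using (to; from)

Derivable≤ : HornProgram → ℕ → Atom → Set
Derivable≤ H zero    x = ⊥
Derivable≤ H (suc n) x = Any (λ r → hd r ≡ x × All (Derivable≤ H n) (body r)) H

derivable≤? : ∀ H n → Decidable (Derivable≤ H n)
derivable≤? H zero    x = no λ ()
derivable≤? H (suc n) x = any? (λ r → (hd r ≟ x) ×-dec all? (derivable≤? H n) (body r)) H

derivable≤-mono : ∀ {H m n x} → m ≤ n → Derivable≤ H m x → Derivable≤ H n x
derivable≤-mono {m = suc m} {n = suc n} (s≤s m≤n) =
  Any.map λ (hd≡x , body≤m) → hd≡x , All.map (derivable≤-mono m≤n) body≤m

derivable≤⇒derivable : ∀ {H} n {x} → Derivable≤ H n x → x ∈LM H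
derivable≤⇒derivable (suc n) d with find d
... | _ , r∈H , refl , body≤n = step r∈H (All.map (derivable≤⇒derivable n) body≤n)

mutual
  derivable⇒derivable≤ : ∀ {H x} → x ∈LM H → ∃ λ n → Derivable≤ H n x
  derivable⇒derivable≤ (step r∈H body) =
    let n , body≤n = All-derivable⇒derivable≤ body in suc n , lose r∈H (refl , body≤n)

  All-derivable⇒derivable≤ : ∀ {H xs} → All (_∈LM H) xs → ∃ λ n → All (Derivable≤ H n) xs
  All-derivable⇒derivable≤ []       = zero , []
  All-derivable⇒derivable≤ (d ∷ ds) =
    let m , x≤m   = derivable⇒derivable≤ d
        n , xs≤n = All-derivable⇒derivable≤ ds
    in m ⊔ n , derivable≤-mono (m≤m⊔n m n) x≤m ∷ All.map (derivable≤-mono (m≤n⊔m m n)) xs≤n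

mutual
  derivable-mono : ∀ {H H′} → (∀ {r} → r ∈ H → r ∈ H′) → ∀ {x} → x ∈LM H → x ∈LM H′
  derivable-mono H⊆H′ (step r∈H body) = step (H⊆H′ r∈H) (All-derivable-mono H⊆H′ body)

  All-derivable-mono : ∀ {H H′} → (∀ {r} → r ∈ H → r ∈ H′) → ∀ {xs} → All (_∈LM H) xs → All (_∈LM H′) xs
  All-derivable-mono H⊆H′ []       = []
  All-derivable-mono H⊆H′ (d ∷ ds) = derivable-mono H⊆H′ d ∷ All-derivable-mono H⊆H′ ds

first-crossing : ∀ {Q : ℕ → Set} → Decidable Q → ¬ Q 0 → ∀ {N} → Q N → ∃ λ n → ¬ Q n × Q (suc n)
first-crossing Q? ¬Q0 {zero}  QN = contradiction QN ¬Q0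
first-crossing Q? ¬Q0 {suc N} QN with Q? N
... | yes QN′ = first-crossing Q? ¬Q0 QN′
... | no ¬QN  = N , ¬QN , QN

∈-reduct⁻ : ∀ {P M r′} → r′ ∈ reduct P M →
  ∃ λ r → r ∈ P × Disjoint (bNeg r) M × r′ ≡ mkHorn (h r) (bPos r)
∈-reduct⁻ {P} {M} r′∈ with ∈-map⁻ (λ r → mkHorn (h r) (bPos r)) r′∈
... | r , r∈filter , refl with ∈-filter⁻ (λ r → disjoint? (bNeg r) M) {xs = P} r∈filter
... | r∈P , negDisj = r , r∈P , negDisj , refl

∈-reduct⁺ : ∀ {P M r} → r ∈ P → Disjoint (bNeg r) M → mkHorn (h r) (bPos r) ∈ reduct P M
∈-reduct⁺ {M = M} r∈P negDisj =
  ∈-map⁺ (λ r → mkHorn (h r) (bPos r)) (∈-filter⁺ (λ r → disjoint? (bNeg r) M) r∈P negDisj)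

∈-restrict⁺ : ∀ {P A r} → r ∈ P → Disjoint (bNeg r) A → All (_∈ A) (bPos r) → r ∈ restrict P A
∈-restrict⁺ r∈P negDisj pos⊆A = ∈-filter⁺ _ r∈P (negDisj , pos⊆A)

Disjoint-⊆ : ∀ {xs X Y} → Y ⊆ X → Disjoint xs X → Disjoint xs Y
Disjoint-⊆ Y⊆X = All.map λ x∉X x∈Y → x∉X (Y⊆X x∈Y)

reduct-antitone : ∀ {P X Y} → Y ⊆ X → ∀ {r} → r ∈ reduct P X → r ∈ reduct P Y
reduct-antitone {P} Y⊆X r′∈ with ∈-reduct⁻ {P} r′∈
... | r , r∈P , negDisj , refl = ∈-reduct⁺ r∈P (Disjoint-⊆ Y⊆X negDisj)

stableModel-resp-≐ : ∀ {P X Y} → StableModel P Y → X ≐ Y → StableModel P X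
stableModel-resp-≐ {P} {X} {Y} (Y⊆At , Y≐LM) X≐Y =
  Y⊆At ∘ to (X≐Y _) ,
  λ x → mk⇔ (derivable-mono (reduct-antitone {P} X⊆Y) ∘ to (Y≐LM x) ∘ to (X≐Y x))
            (from (X≐Y x) ∘ from (Y≐LM x) ∘ derivable-mono (reduct-antitone {P} Y⊆X))
  where
  X⊆Y : X ⊆ Y
  X⊆Y = to (X≐Y _)
  Y⊆X : Y ⊆ X
  Y⊆X = from (X≐Y _)

∈-∷⇔ : ∀ {x a} {A : List Atom} → (x ∈ a ∷ A) ⇔ ((x ≡ a) ⊎ (x ∈ A))
∈-∷⇔ = ⇔-sym (↔⇒⇔ (∷↔ _))

↭⇒≐ : ∀ {X Y} → X ↭ Y → X ≐ Y
↭⇒≐ X↭Y x = mk⇔ (∈-resp-↭ X↭Y) (∈-resp-↭ (↭-sym X↭Y))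

∈⇒↭∷ : ∀ {a} {M : List Atom} → a ∈ M → ∃ λ A → M ↭ a ∷ A
∈⇒↭∷ {a} a∈M with ys , zs , refl ← ∈-∃++ a∈M = _ , shift a ys zs

derivable≤-suc-restrict : ∀ {P M A} n → A ⊆ M →
  (∀ {b} → Derivable≤ (reduct P M) n b → b ∈ A) →
  ∀ {x} → Derivable≤ (reduct P M) (suc n) x → x ∈LM reduct (restrict P A) M
derivable≤-suc-restrict {P} {M} {A} n A⊆M lowerInA d with find d
... | _ , r′∈ , refl , body≤n with ∈-reduct⁻ {P} r′∈
... | r , r∈P , negDisj , refl =
  step (∈-reduct⁺ (∈-restrict⁺ {P} r∈P (Disjoint-⊆ A⊆M negDisj) (All.map lowerInA body≤n)) negDisj)
       (derivable-body n lowerInA body≤n)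
  where
  derivable-body : ∀ m → (∀ {b} → Derivable≤ (reduct P M) m b → b ∈ A) →
    ∀ {xs} → All (Derivable≤ (reduct P M) m) xs → All (_∈LM reduct (restrict P A) M) xs
  derivable-body zero    _        = All.map λ ()
  derivable-body (suc m) lowerInA =
    All.map (derivable≤-suc-restrict {P} m A⊆M (lowerInA ∘ derivable≤-mono (n≤1+n m)))

module _ {P : Program} {M : List Atom} (stable : StableModel P M) where

  private
    H : HornProgram
    H = reduct P M

  crossing-depth : ∀ {a₀} → a₀ ∈ M →
    ∃ λ n → ¬ All (Derivable≤ H n) M × All (Derivable≤ H (suc n)) M
  crossing-depth a₀∈M =
    first-crossing (λ n → all? (derivable≤? H n) M) (λ all₀ → All.lookup all₀ a₀∈M)
      (proj₂ (All-derivable⇒derivable≤ (All.tabulate (to (proj₂ stable _)))))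

  aBased-at-crossing : ∀ {n a A} → M ↭ a ∷ A → a ∉ A → ¬ Derivable≤ H n a →
    All (Derivable≤ H (suc n)) M → ABased P A M
  aBased-at-crossing {n} {a} {A} M↭a∷A a∉A a≰n M≤suc =
    stable , (a , proj₁ stable (from (M≐a∷A _) (here refl)) , a∉A , M≐a⊎A) ,
    derivable≤-suc-restrict {P} n (from (M≐a∷A _) ∘ there) lowerInA ∘ All.lookup M≤suc
    where
    M≐a∷A : M ≐ (a ∷ A)
    M≐a∷A = ↭⇒≐ M↭a∷A
    M≐a⊎A : ∀ x → (x ∈ M) ⇔ ((x ≡ a) ⊎ (x ∈ A))
    M≐a⊎A x = ∈-∷⇔ ⇔-∘ M≐a∷A x
    lowerInA : ∀ {b} → Derivable≤ H n b → b ∈ A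
    lowerInA {b} b≤n with to (M≐a⊎A b) (from (proj₂ stable b) (derivable≤⇒derivable n b≤n))
    ... | inj₁ refl = contradiction b≤n a≰n
    ... | inj₂ b∈A  = b∈A

  stableModel⇒aBased : Unique M → ∀ {a₀} → a₀ ∈ M →
    ∃ λ A → Unique A × A ⊆ At P × length M ≡ suc (length A) × ABased P A M
  stableModel⇒aBased uniqueM a₀∈M
    with n , M≰n , M≤suc ← crossing-depth a₀∈M
    with a , a∈M , a≰n ← find (¬All⇒Any¬ (derivable≤? H n) M M≰n)
    with A , M↭a∷A ← ∈⇒↭∷ a∈M
    with a∉A ∷ uniqueA ← Unique-resp-↭ (setoid Atom) (↭⇒↭ₛ M↭a∷A) uniqueM =
    A , uniqueA , proj₁ stable ∘ from (↭⇒≐ M↭a∷A _) ∘ there , ↭-length M↭a∷A ,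
    aBased-at-crossing M↭a∷A (All¬⇒¬Any a∉A) a≰n M≤suc

aBased⇒stableModel : ∀ {P A M} → Unique A → ABased P A M →
  ∃ λ a → Unique (a ∷ A) × StableModel P (a ∷ A)
aBased⇒stableModel {P} uniqueA (stable , (a , _ , a∉A , M≐a⊎A) , _) =
  a , ¬Any⇒All¬ _ a∉A ∷ uniqueA ,
  stableModel-resp-≐ {P} stable λ x → ⇔-sym (M≐a⊎A x) ⇔-∘ ∈-∷⇔

mainTheorem3 : (k : ℕ) → 1 ≤ k → (P : Program) → WellFormed P → Proper P →
    (Σ (List Atom) (λ M → Unique M × length M ≡ k × StableModel P M))
    ⇔ (Σ (List Atom) (λ A → Unique A × A ⊆ At P × length A ≡ k ∸ 1 ×
         Σ (List Atom) (λ M → ABased P A M)))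
mainTheorem3 (suc k) _ P _ _ = mk⇔
  (λ { ([] , _ , () , _)
     ; (M@(_ ∷ _) , uniqueM , |M|≡1+k , stable) →
         let A , uniqueA , A⊆At , |M|≡1+|A| , aBased = stableModel⇒aBased {P} stable uniqueM (here refl)
         in A , uniqueA , A⊆At , suc-injective (trans (sym |M|≡1+|A|) |M|≡1+k) , M , aBased })
  (λ (A , uniqueA , _ , |A|≡k , _ , aBased) →
     let a , uniqueA′ , stable = aBased⇒stableModel {P} uniqueA aBased
     in a ∷ A , uniqueA′ , cong suc |A|≡k , stable)
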